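{- Let $A$ and $B$ be two disjoint bases of a matroid $M$. Let $a_1,\dots,a_m\in A$ be distinct and $b_1,\dots,b_m\in B$ be distinct, and suppose that for each $i=1,\dots,m$ the set $(B\setminus\{b_1,\dots,b_i\})\cup\{a_1,\dots,a_i\}$ is a base (i.e. $(\{a_1\prec\cdots\prec a_m\},\{b_1\prec\cdots\prec b_m\})$ is a serial exchange relative to $B$). Let $A_0=B_0=\emptyset$ and for $k=1,\dots,m$ let $A_k=\{a_1,\dots,a_k\}$, $B_k=\{b_1,\dots,b_k\}$. Then for every $k=1,\dots,m$, $$\bigcup_{i=1}^{k}C(B,a_i)=\bigcup_{i=1}^{k}\Big(C\big((B\setminus B_{i-1})\cup A_{i-1},\,a_i\big)\cap B\Big).$$
   Context: For an independent set $I$ and an element $x$ such that $I\cup\{x\}$ is dependent, $C(I,x)$ denotes the unique minimal subset of $I$ that spans $x$ (equivalently, $C(I,x)\cup\{x\}$ is the unique circuit contained in $I\cup\{x\}$, and $C(I,x)$ is this circuit minus $x$). -}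

module Defs where

open import Level using (Level; suc; _⊔_)
open import Data.Nat using (ℕ; _<_; _<?_)
open import Data.Fin using (Fin; toℕ)
open import Data.Fin.Subset using (Subset; _∈_; _∉_; _⊆_; _⊂_; _∪_; ⁅_⁆; ∣_∣; ⊥; ⋃)
open import Data.List using (List; map; filter; allFin)
open import Data.Product using (Σ; _×_; ∃)
open import Relation.Nullary using (¬_)
open import Relation.Binary.PropositionalEquality using (_≡_)

record Matroid (n : ℕ) : Set₁ where
  field
    Indep         : Subset n → Set
    indep-empty   : Indep ⊥
    indep-subset  : ∀ {I J} → J ⊆ I → Indep I → Indep J
    indep-augment : ∀ {I J} → Indep I → Indep J → ∣ I ∣ < ∣ J ∣ →
                    Σ (Fin n) λ x → x ∈ J × x ∉ I × Indep (I ∪ ⁅ x ⁆)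

module _ {n : ℕ} (M : Matroid n) where
  open Matroid M

  IsBase : Subset n → Set
  IsBase B = Indep B × (∀ X → B ⊆ X → Indep X → X ⊆ B)

  IsCircuit : Subset n → Set
  IsCircuit C = ¬ Indep C × (∀ D → D ⊂ C → Indep D)

  -- IsFundCircuit I x C : C is C(I,x), i.e. C ⊆ I and C ∪ {x} is a circuit
  -- (for I independent and I ∪ {x} dependent this C is unique).
  IsFundCircuit : Subset n → Fin n → Subset n → Set
  IsFundCircuit I x C = C ⊆ I × x ∉ C × IsCircuit (C ∪ ⁅ x ⁆)

-- prefix f k = { f j | j < k }  (0-based indices), i.e. {f_1,…,f_k} in 1-based notation.
prefix : {m n : ℕ} → (Fin m → Fin n) → ℕ → Subset n
prefix {m} f k = ⋃ (map (λ j → ⁅ f j ⁆) (filter (λ j → toℕ j <? k) (allFin m)))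

-- Write cl for the matroid closure. Suppose z ∈ B lies in none of the sets of one family.
-- Each fundamental circuit of that family lies in B ∪ {a_1,…,a_(j-1)}, hence avoids z, so
-- by induction on j every a_j is in cl(B − z). Any circuit of the other family containing
-- z lies in B ∪ {a_1,…,a_k}; removing z from it leaves an independent set spanning z
-- inside cl(B − z), so z ∈ cl(B − z), which contradicts the independence of B. Both
-- families consist of fundamental circuits of the a_j over subsets of B ∪ {a_1,…,a_(j-1)},
-- so the argument is symmetric and gives both inclusions.
module Submission where

open import Defs
open import Data.Nat using (ℕ; zero; suc; _≤_; _<_; _+_; _<?_; _≤?_)
open import Data.Nat.Properties
  using (≮⇒≥; <⇒≱; ≰⇒>; <-≤-trans; m<n⇒m<1+n; <⇒≤; ≤-pred; ≤-trans; m≤m+n; +-suc; +-monoʳ-≤)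
open import Data.Fin using (Fin; toℕ; _≟_)
open import Data.Fin.Subset using (Subset; _∈_; _∉_; _⊆_; _∩_; _∪_; _─_; _-_; ⁅_⁆; ∣_∣; ⊥; ⋃)
open import Data.Fin.Subset.Properties
  using ( _∈?_; ∉⊥; x∈⁅x⁆; x∈⁅y⁆⇒x≡y; ⊆-trans; ⊆-antisym; p⊆p∪q; q⊆p∪q; x∈p∪q⁻; x∈p∪q⁺
        ; x∈p∩q⁺; x∈p∩q⁻; p∩q⊆p; p─q⊆p; x∈p∧x≢y⇒x∈p-y; x∈p⇒p-x⊂p; p⊂q⇒∣p∣<∣q∣ )
open import Data.List using (List; []; _∷_; map; filter; allFin)
open import Data.List.Membership.Propositional using () renaming (_∈_ to _∈ₗ_)
open import Data.List.Membership.Propositional.Properties using (∈-map⁺; ∈-map⁻; ∈-filter⁺; ∈-filter⁻; ∈-allFin)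
open import Data.List.Relation.Unary.Any using (here; there)
open import Data.Vec using (_∷_; here; there)
open import Data.Product using (∃-syntax; _×_; _,_; proj₁; proj₂)
open import Data.Sum using (inj₁; inj₂; [_,_]′)
import Data.Sum as Sum
open import Function using (id; _∘_)
open import Function.Definitions using (Injective)
open import Relation.Nullary using (¬_; yes; no; contradiction)
open import Relation.Binary.PropositionalEquality using (_≡_; refl; sym; subst)

private
  variable
    n : ℕ
    x : Fin n
    p q r p′ q′ : Subset n

x∈p─q⇒x∉q : ∀ (p q : Subset n) → x ∈ p ─ q → x ∉ q
x∈p─q⇒x∉q (_ ∷ p) (_ ∷ q) (there x∈p─q) (there x∈q) = x∈p─q⇒x∉q p q x∈p─q x∈q

x∉p-x : ∀ (p : Subset n) → x ∉ p - x
x∉p-x {x = x} p x∈p-x = x∈p─q⇒x∉q p ⁅ x ⁆ x∈p-x (x∈⁅x⁆ x)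

x∈p⇒⁅x⁆⊆p : x ∈ p → ⁅ x ⁆ ⊆ p
x∈p⇒⁅x⁆⊆p {x = x} x∈p y∈⁅x⁆ = subst (_∈ _) (sym (x∈⁅y⁆⇒x≡y x y∈⁅x⁆)) x∈p

∪-lub : p ⊆ r → q ⊆ r → p ∪ q ⊆ r
∪-lub {p = p} {q = q} p⊆r q⊆r = [ p⊆r , q⊆r ]′ ∘ x∈p∪q⁻ p q

∪-mono : p ⊆ p′ → q ⊆ q′ → p ∪ q ⊆ p′ ∪ q′
∪-mono {p = p} {q = q} p⊆p′ q⊆q′ = x∈p∪q⁺ ∘ Sum.map p⊆p′ q⊆q′ ∘ x∈p∪q⁻ p q

p⊆p-x∪⁅x⁆ : ∀ (p : Subset n) (x : Fin n) → p ⊆ (p - x) ∪ ⁅ x ⁆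
p⊆p-x∪⁅x⁆ p x {y} y∈p with y ≟ x
... | yes refl = q⊆p∪q (p - x) ⁅ x ⁆ (x∈⁅x⁆ x)
... | no y≢x   = p⊆p∪q ⁅ x ⁆ (x∈p∧x≢y⇒x∈p-y y∈p y≢x)

p-x∪⁅x⁆⊆p : x ∈ p → (p - x) ∪ ⁅ x ⁆ ⊆ p
p-x∪⁅x⁆⊆p {p = p} x∈p = ∪-lub (p─q⊆p p _) (x∈p⇒⁅x⁆⊆p x∈p)

p⊆q∪r∧x∉p⇒p⊆q-x∪r : p ⊆ q ∪ r → x ∉ p → p ⊆ (q - x) ∪ r
p⊆q∪r∧x∉p⇒p⊆q-x∪r {q = q} {r = r} {x = x} p⊆q∪r x∉p {y} y∈p with x∈p∪q⁻ q r (p⊆q∪r y∈p)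
... | inj₂ y∈r = q⊆p∪q (q - x) r y∈r
... | inj₁ y∈q = p⊆p∪q r (x∈p∧x≢y⇒x∈p-y y∈q λ { refl → x∉p y∈p })

x∉p⇒∣p∣<∣p∪⁅x⁆∣ : x ∉ p → ∣ p ∣ < ∣ p ∪ ⁅ x ⁆ ∣
x∉p⇒∣p∣<∣p∪⁅x⁆∣ {x = x} {p = p} x∉p =
  p⊂q⇒∣p∣<∣q∣ (p⊆p∪q ⁅ x ⁆ , x , q⊆p∪q p ⁅ x ⁆ (x∈⁅x⁆ x) , x∉p)

x∈⋃⁻ : ∀ (ps : List (Subset n)) → x ∈ ⋃ ps → ∃[ p ] p ∈ₗ ps × x ∈ p
x∈⋃⁻ []       x∈⊥ = contradiction x∈⊥ ∉⊥
x∈⋃⁻ (p ∷ ps) x∈⋃ with x∈p∪q⁻ p (⋃ ps) x∈⋃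
... | inj₁ x∈p = p , here refl , x∈p
... | inj₂ x∈⋃ps with x∈⋃⁻ ps x∈⋃ps
...   | q , q∈ps , x∈q = q , there q∈ps , x∈q

x∈⋃⁺ : ∀ {ps : List (Subset n)} → p ∈ₗ ps → x ∈ p → x ∈ ⋃ ps
x∈⋃⁺ {ps = p ∷ ps} (here refl) x∈p = p⊆p∪q (⋃ ps) x∈p
x∈⋃⁺ {ps = q ∷ ps} (there p∈ps) x∈p = q⊆p∪q q (⋃ ps) (x∈⋃⁺ p∈ps x∈p)

-- Definitionally the unions in the statement; prefix a k is ⋃< (λ j → ⁅ a j ⁆) k.
⋃< : {m : ℕ} → (Fin m → Subset n) → ℕ → Subset n
⋃< {m = m} f k = ⋃ (map f (filter (λ i → toℕ i <? k) (allFin m)))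

module _ {m : ℕ} where

  x∈⋃<⁻ : ∀ (f : Fin m → Subset n) k → x ∈ ⋃< f k → ∃[ i ] toℕ i < k × x ∈ f i
  x∈⋃<⁻ f k x∈⋃ with x∈⋃⁻ (map f (filter (λ i → toℕ i <? k) (allFin m))) x∈⋃
  ... | _ , fi∈ , x∈fi with ∈-map⁻ f fi∈
  ...   | i , i∈ , refl = i , proj₂ (∈-filter⁻ (λ i → toℕ i <? k) {xs = allFin m} i∈) , x∈fi

  x∈⋃<⁺ : ∀ {f : Fin m → Subset n} {k} (i : Fin m) → toℕ i < k → x ∈ f i → x ∈ ⋃< f k
  x∈⋃<⁺ {f = f} {k} i i<k = x∈⋃⁺ (∈-map⁺ f (∈-filter⁺ (λ i → toℕ i <? k) (∈-allFin i) i<k))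

  ⋃<-mono : ∀ {f g : Fin m → Subset n} k → (∀ i → f i ⊆ g i) → ⋃< f k ⊆ ⋃< g k
  ⋃<-mono {f = f} k f⊆g x∈⋃ with x∈⋃<⁻ f k x∈⋃
  ... | i , i<k , x∈fi = x∈⋃<⁺ i i<k (f⊆g i x∈fi)

  x∈prefix⁻ : ∀ (a : Fin m → Fin n) k → x ∈ prefix a k → ∃[ j ] toℕ j < k × x ≡ a j
  x∈prefix⁻ a k x∈ with x∈⋃<⁻ (λ j → ⁅ a j ⁆) k x∈
  ... | j , j<k , x∈⁅aj⁆ = j , j<k , x∈⁅y⁆⇒x≡y (a j) x∈⁅aj⁆

  a∈prefix : ∀ (a : Fin m → Fin n) {k} j → toℕ j < k → a j ∈ prefix a k
  a∈prefix a j j<k = x∈⋃<⁺ j j<k (x∈⁅x⁆ (a j))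

  prefix-mono : ∀ (a : Fin m → Fin n) {k l} → k ≤ l → prefix a k ⊆ prefix a l
  prefix-mono a {k} k≤l x∈ with x∈prefix⁻ a k x∈
  ... | j , j<k , refl = a∈prefix a j (<-≤-trans j<k k≤l)

module _ (M : Matroid n) where
  open Matroid M

  -- For independent I this says y ∈ cl(I); it is not the closure for dependent I.
  Spans : Subset n → Fin n → Set
  Spans I y = y ∉ I → ¬ Indep (I ∪ ⁅ y ⁆)

  SpansAll : Subset n → Subset n → Set
  SpansAll I Y = ∀ {y} → y ∈ Y → Spans I y

  fundCircuit-mono : ∀ {I J X} → I ⊆ J → IsFundCircuit M I x X → IsFundCircuit M J x X
  fundCircuit-mono I⊆J (X⊆I , rest) = ⊆-trans X⊆I I⊆J , rest

  fundCircuit-indep : ∀ {I X} → IsFundCircuit M I x X → Indep X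
  fundCircuit-indep {x = x} {X = X} (_ , x∉X , _ , minimal) =
    minimal X (p⊆p∪q ⁅ x ⁆ , x , q⊆p∪q X ⁅ x ⁆ (x∈⁅x⁆ x) , x∉X)

  indep-extend : ∀ {P Q} → Indep P → Indep Q →
    ∃[ K ] Indep K × P ⊆ K × K ⊆ P ∪ Q × ∣ Q ∣ ≤ ∣ K ∣
  indep-extend {P} {Q} iP iQ = go ∣ Q ∣ iP (m≤m+n ∣ Q ∣ ∣ P ∣)
    where
    go : ∀ fuel {P} → Indep P → ∣ Q ∣ ≤ fuel + ∣ P ∣ →
      ∃[ K ] Indep K × P ⊆ K × K ⊆ P ∪ Q × ∣ Q ∣ ≤ ∣ K ∣
    go fuel {P} iP bound with ∣ Q ∣ ≤? ∣ P ∣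
    ... | yes Q≤P = P , iP , id , p⊆p∪q Q , Q≤P
    ... | no Q≰P with fuel | indep-augment iP iQ (≰⇒> Q≰P)
    ...   | zero      | _ = contradiction bound Q≰P
    ...   | suc fuel′ | y , y∈Q , y∉P , iPy with go fuel′ iPy bound′
      where
      bound′ : ∣ Q ∣ ≤ fuel′ + ∣ P ∪ ⁅ y ⁆ ∣
      bound′ = ≤-trans bound (subst (_≤ fuel′ + ∣ P ∪ ⁅ y ⁆ ∣) (+-suc fuel′ ∣ P ∣)
                 (+-monoʳ-≤ fuel′ (x∉p⇒∣p∣<∣p∪⁅x⁆∣ y∉P)))
    ...     | K , iK , Py⊆K , K⊆Py∪Q , Q≤K =
      K , iK , Py⊆K ∘ p⊆p∪q ⁅ y ⁆ ,
      ⊆-trans K⊆Py∪Q (∪-lub (∪-lub (p⊆p∪q Q) (x∈p⇒⁅x⁆⊆p (q⊆p∪q P Q y∈Q))) (q⊆p∪q P Q)) ,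
      Q≤K

  ∣indep∣≤∣spanning∣ : ∀ {I Y J} → Indep I → SpansAll I Y → Indep J → J ⊆ I ∪ Y → ∣ J ∣ ≤ ∣ I ∣
  ∣indep∣≤∣spanning∣ {I} {Y} iI spans iJ J⊆I∪Y = ≮⇒≥ λ I<J →
    let (y , y∈J , y∉I , iIy) = indep-augment iI iJ I<J
    in [ y∉I , (λ y∈Y → spans y∈Y y∉I iIy) ]′ (x∈p∪q⁻ I Y (J⊆I∪Y y∈J))

  -- Extend F to an independent K ⊆ F ∪ I ∪ {y} of size > ∣ I ∣: either y ∈ K, and then
  -- F ∪ {y} ⊆ K, or K ⊆ I ∪ Y, which is too large to be independent.
  spans-trans : ∀ {I Y F y} → Indep I → SpansAll I Y → Indep F → ¬ Indep (F ∪ ⁅ y ⁆) →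
    F ⊆ I ∪ Y → Spans I y
  spans-trans {I} {Y} {F} {y} iI spans iF dep F⊆I∪Y y∉I iIy with indep-extend iF iIy
  ... | K , iK , F⊆K , K⊆F∪Iy , Iy≤K with y ∈? K
  ...   | yes y∈K = dep (indep-subset (∪-lub F⊆K (x∈p⇒⁅x⁆⊆p y∈K)) iK)
  ...   | no y∉K = <⇒≱ (<-≤-trans (x∉p⇒∣p∣<∣p∪⁅x⁆∣ y∉I) Iy≤K)
                     (∣indep∣≤∣spanning∣ iI spans iK K⊆I∪Y)
    where
    K⊆I∪Y : K ⊆ I ∪ Y
    K⊆I∪Y {w} w∈K with x∈p∪q⁻ F (I ∪ ⁅ y ⁆) (K⊆F∪Iy w∈K)
    ... | inj₁ w∈F = F⊆I∪Y w∈F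
    ... | inj₂ w∈Iy with x∈p∪q⁻ I ⁅ y ⁆ w∈Iy
    ...   | inj₁ w∈I = p⊆p∪q Y w∈I
    ...   | inj₂ w∈⁅y⁆ = contradiction (subst (_∈ K) (x∈⁅y⁆⇒x≡y y w∈⁅y⁆) w∈K) y∉K

  indep⇒¬Spans-rest : ∀ {B} → Indep B → x ∈ B → ¬ Spans (B - x) x
  indep⇒¬Spans-rest {B = B} iB x∈B spans = spans (x∉p-x B) (indep-subset (p-x∪⁅x⁆⊆p x∈B) iB)

  circuit⊆B∪spanned⇒∉ : ∀ {B Y Z z} → Indep B → z ∈ B → SpansAll (B - z) Y →
    IsCircuit M Z → Z ⊆ B ∪ Y → z ∉ Z
  circuit⊆B∪spanned⇒∉ {B} {Y} {Z} {z} iB z∈B spans (depZ , minimal) Z⊆B∪Y z∈Z =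
    indep⇒¬Spans-rest iB z∈B
      (spans-trans (indep-subset (p─q⊆p B _) iB) spans
        (minimal (Z - z) (x∈p⇒p-x⊂p z∈Z))
        (depZ ∘ indep-subset (p⊆p-x∪⁅x⁆ Z z))
        (p⊆q∪r∧x∉p⇒p⊆q-x∪r (⊆-trans (p─q⊆p Z _) Z⊆B∪Y) (x∉p-x Z)))

  prefix-spanned : ∀ {m I} → Indep I → (a : Fin m → Fin n) (X : Fin m → Subset n) → ∀ k →
    (∀ j → toℕ j < k → IsFundCircuit M (I ∪ prefix a (toℕ j)) (a j) (X j)) →
    SpansAll I (prefix a k)
  prefix-spanned iI a X k fc y∈ with x∈prefix⁻ a k y∈
  prefix-spanned iI a X (suc k) fc y∈ | j , j<1+k , refl =
    spans-trans iI earlier (fundCircuit-indep (fc j j<1+k))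
      (proj₁ (proj₂ (proj₂ (fc j j<1+k)))) (proj₁ (fc j j<1+k))
    where
    earlier : SpansAll _ (prefix a (toℕ j))
    earlier = prefix-spanned iI a X k (λ i i<k → fc i (m<n⇒m<1+n i<k))
                ∘ prefix-mono a (≤-pred j<1+k)

  ⋃<-fundCircuits∩-⊆ : ∀ {m B} → Indep B → (a : Fin m → Fin n) (X X′ : Fin m → Subset n) →
    (∀ j → IsFundCircuit M (B ∪ prefix a (toℕ j)) (a j) (X j)) →
    (∀ j → IsFundCircuit M (B ∪ prefix a (toℕ j)) (a j) (X′ j)) →
    ∀ k → ⋃< (λ j → X j ∩ B) k ⊆ ⋃< (λ j → X′ j ∩ B) k
  ⋃<-fundCircuits∩-⊆ {B = B} iB a X X′ fc fc′ k {z} z∈ with z ∈? ⋃< (λ j → X′ j ∩ B) k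
  ... | yes z∈′ = z∈′
  ... | no z∉′ with x∈⋃<⁻ _ k z∈
  ...   | i , i<k , z∈Xi∩B with x∈p∩q⁻ (X i) B z∈Xi∩B
  ...     | z∈Xi , z∈B =
    contradiction (p⊆p∪q ⁅ a i ⁆ z∈Xi)
      (circuit⊆B∪spanned⇒∉ iB z∈B spanned (proj₂ (proj₂ (fc i))) Zi⊆)
    where
    spanned : SpansAll (B - z) (prefix a k)
    spanned = prefix-spanned (indep-subset (p─q⊆p B _) iB) a X′ k λ j j<k →
      p⊆q∪r∧x∉p⇒p⊆q-x∪r (proj₁ (fc′ j)) (λ z∈X′j → z∉′ (x∈⋃<⁺ j j<k (x∈p∩q⁺ (z∈X′j , z∈B))))
      , proj₂ (fc′ j)
    Zi⊆ : X i ∪ ⁅ a i ⁆ ⊆ B ∪ prefix a k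
    Zi⊆ = ∪-lub (⊆-trans (proj₁ (fc i)) (∪-mono id (prefix-mono a (<⇒≤ i<k))))
                (x∈p⇒⁅x⁆⊆p (q⊆p∪q B _ (a∈prefix a i i<k)))

lemma2p9 : {n m : ℕ} (M : Matroid n) (A B : Subset n) →
    IsBase M A → IsBase M B → A ∩ B ≡ ⊥ →
    (a b : Fin m → Fin n) →
    Injective _≡_ _≡_ a → Injective _≡_ _≡_ b →
    (∀ i → a i ∈ A) → (∀ i → b i ∈ B) →
    (∀ (i : Fin m) → IsBase M ((B ─ prefix b (suc (toℕ i))) ∪ prefix a (suc (toℕ i)))) →
    (C D : Fin m → Subset n) →
    (∀ i → IsFundCircuit M B (a i) (C i)) →
    (∀ i → IsFundCircuit M ((B ─ prefix b (toℕ i)) ∪ prefix a (toℕ i)) (a i) (D i)) →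
    (k : ℕ) → 1 ≤ k → k ≤ m →
    ⋃ (map C (filter (λ i → toℕ i <? k) (allFin m)))
      ≡ ⋃ (map (λ i → D i ∩ B) (filter (λ i → toℕ i <? k) (allFin m)))
lemma2p9 M A B _ (iB , _) _ a b _ _ _ _ _ C D C-fund D-fund k _ _ =
  ⊆-antisym (⊆-trans (⋃<-mono k C⊆C∩B) (⋃<-fundCircuits∩-⊆ M iB a C D C-fund′ D-fund′ k))
            (⊆-trans (⋃<-fundCircuits∩-⊆ M iB a D C D-fund′ C-fund′ k) (⋃<-mono k λ i → p∩q⊆p (C i) B))
  where
  C⊆C∩B : ∀ i → C i ⊆ C i ∩ B
  C⊆C∩B i w∈ = x∈p∩q⁺ (w∈ , proj₁ (C-fund i) w∈)
  C-fund′ : ∀ i → IsFundCircuit M (B ∪ prefix a (toℕ i)) (a i) (C i)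
  C-fund′ i = fundCircuit-mono M (p⊆p∪q _) (C-fund i)
  D-fund′ : ∀ i → IsFundCircuit M (B ∪ prefix a (toℕ i)) (a i) (D i)
  D-fund′ i = fundCircuit-mono M (∪-mono (p─q⊆p B _) id) (D-fund i)
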